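{- Let $t\ge 5$ be odd. If a non-adaptive $(m,s,t)$-graph $G$ is admissible for sets of size at most $n$ (where $1\le n\le m$), then the non-adaptive $(m,ts,t)$-query scheme $\mathcal{T}_G$ is satisfiable for every set $S\subseteq[m]$ of size at most $n$.
   Context: $\lg$ is logarithm base 2. A non-adaptive $(m,s,t)$-graph is a bipartite graph $G$ with vertex sets $U=[m]$ and $V=V_1\cup\dots\cup V_t$ (disjoint, each of size $s$), in which every $u\in U$ has a unique neighbour in each $V_i$. The query scheme $\mathcal{T}_G$ uses a memory of $ts$ bits indexed by $V$ and answers ``Is $u\in S$?'' with Yes iff the majority of the $t$ locations in the neighbourhood of $u$ contain $1$. $\mathcal{T}_G$ is satisfiable for $S$ if some assignment to the memory makes all such queries ($u\in[m]$) answered correctly. $\Gamma_G(R)$ is the set of neighbours of $R$ in $G$. $G$ is admissible for sets of size at most $n$ if (P1) every $R\subseteq[m]$ with $|R|\le n+\lceil 2n\lg\frac{2m}{n}\rceil$ satisfies $|\Gamma_G(R)|\ge\frac{t+1}{2}|R|$; and (P2) every $S\subseteq[m]$ with $|S|=n$ satisfies $|T_S|\le\lceil 2n\lg\frac{2m}{n}\rceil$, where $T_S=\{y\in[m]\setminus S: |\Gamma_G(y)\cap\Gamma_G(S)|\ge\frac{t+1}{2}\}$. -}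

module Defs where

open import Data.Nat using (ℕ; zero; suc; _+_; _*_; _^_; _≤_; _≤ᵇ_; _/_)
open import Data.Bool using (Bool; true; false; _∧_; _∨_; not)
open import Data.Fin using (Fin; combine; remQuot; _≟_)
open import Data.Fin.Subset using (Subset; _∈_; ∣_∣; _∩_; _─_)
open import Data.Vec using (Vec; tabulate; lookup; count)
open import Data.Product using (Σ; _×_; _,_; proj₁; proj₂)
open import Relation.Nullary using (Dec; yes; no; does)
open import Relation.Nullary.Decidable using (⌊_⌋)
open import Function.Bundles using (_⇔_)
open import Relation.Binary.PropositionalEquality using (_≡_)
open import Data.List using (List)
open import Data.Bool.ListAction using (any)
open import Data.List.Base using (allFin) renaming (map to mapL)

-- A non-adaptive (m,s,t)-graph: U = Fin m, V = V_1 ∪ … ∪ V_t with V_i ≅ Fin s.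
-- Every u has a unique neighbour in each V_i, given by the function
-- nbr u i ∈ V_i.  The vertex (i , v) of V is encoded as combine i v : Fin (t * s).
NAGraph : ℕ → ℕ → ℕ → Set
NAGraph m s t = Fin m → Fin t → Fin s

Memory : ℕ → ℕ → Set
Memory s t = Fin t → Fin s → Bool

memb : ∀ {m} → Fin m → Subset m → Bool
memb u R = lookup R u

Γ : ∀ {m s t} → NAGraph m s t → Subset m → Subset (t * s)
Γ {m} {s} {t} G R = tabulate λ x →
  let (i , v) = remQuot {t} s x in
  any (λ u → memb u R ∧ ⌊ G u i ≟ v ⌋) (allFin m)

Γ₁ : ∀ {m s t} → NAGraph m s t → Fin m → Subset (t * s)
Γ₁ {m} {s} {t} G y = tabulate λ x →
  let (i , v) = remQuot {t} s x in ⌊ G y i ≟ v ⌋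

ones : ∀ {m s t} → NAGraph m s t → Memory s t → Fin m → ℕ
ones {t = t} G M u = count (λ i → M i (G u i) Data.Bool.≟ true) (tabulate {n = t} (λ i → i))

-- T_G answers "Is u ∈ S?" with Yes iff the majority of the t locations
-- contain 1, i.e. 2 * ones > t  (t odd, so this is ones ≥ (t+1)/2).
answersYes : ∀ {m s t} → NAGraph m s t → Memory s t → Fin m → Set
answersYes {t = t} G M u = suc t ≤ 2 * ones G M u

Satisfiable : ∀ {m s t} → NAGraph m s t → Subset m → Set
Satisfiable {m} {s} {t} G S =
  Σ (Memory s t) λ M → (u : Fin m) → (answersYes G M u ⇔ (u ∈ S))

-- k = ⌈ 2n lg(2m/n) ⌉  (for 1 ≤ n ≤ m), characterised exactly:
-- k is the least natural with 2^k ≥ (2m/n)^(2n), i.e. 2^k * n^(2n) ≥ (2m)^(2n).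
IsCeilBound : ℕ → ℕ → ℕ → Set
IsCeilBound n m k =
  ((2 * m) ^ (2 * n) ≤ 2 ^ k * n ^ (2 * n)) ×
  (∀ j → (2 * m) ^ (2 * n) ≤ 2 ^ j * n ^ (2 * n) → k ≤ j)

T : ∀ {m s t} → NAGraph m s t → Subset m → Subset m
T {m} {s} {t} G S = tabulate λ y →
  not (memb y S) ∧ (suc t ≤ᵇ 2 * ∣ Γ₁ G y ∩ Γ G S ∣)

-- G admissible for sets of size at most n, with k = ⌈2n lg(2m/n)⌉.
-- (P1) |R| ≤ n + k ⇒ |Γ(R)| ≥ (t+1)/2 |R|   (written 2|Γ(R)| ≥ (t+1)|R|)
-- (P2) |S| = n ⇒ |T_S| ≤ k
Admissible : ∀ {m s t} → NAGraph m s t → ℕ → ℕ → Set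
Admissible {m} {s} {t} G n k =
  ((R : Subset m) → ∣ R ∣ ≤ n + k → suc t * ∣ R ∣ ≤ 2 * ∣ Γ G R ∣) ×
  ((S : Subset m) → ∣ S ∣ ≡ n → ∣ T G S ∣ ≤ k)

-- Let h = (t+1)/2.  Enlarge S to a set S′ of exactly n vertices and put R = S′ ∪ T_{S′},
-- so |R| ≤ n + k.  By (P1) every P ⊆ R has at least h|P| neighbours, so Hall's theorem,
-- applied after replacing every vertex of R by h copies, gives each u ∈ R h private
-- neighbours: locations of Γ(u), in h different blocks V_i, used by no other vertex of R.
-- Store 1 exactly at the private neighbours of the vertices of S.  Then a vertex of S
-- sees at least h ones, a vertex of R ∖ S sees at least h zeros and so at most t − h < h
-- ones, and a vertex u ∉ R sees ones only in Γ(u) ∩ Γ(S′), which has fewer than h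
-- elements because u ∉ T_{S′}.

module Submission where

open import Defs
open import Data.Nat using (ℕ; zero; suc; _≤_; _<_; _+_; _*_; z≤n; s≤s; _≤?_; _<?_; _≤ᵇ_)
open import Data.Nat.Properties using (≤-antisym; m≤n⇒m≤1+n; ≤-trans; +-suc; m≤m+n; ≤-reflexive; +-cancelʳ-≤; +-identityʳ; +-monoʳ-≤; ≤-pred; <-≤-trans; m<n+m; ≰⇒>; ≮⇒≥; <⇒≱; ≤-refl; +-mono-≤; *-suc; *-comm; *-assoc; *-cancelˡ-≤; *-monoʳ-≤; <-irrefl; n<1+n; +-monoˡ-≤; ≤⇒≤ᵇ; module ≤-Reasoning)
open import Data.Nat.Divisibility using (_∣_; _∣0; ∣-refl; ∣m∣n⇒∣m+n)
open import Data.Bool using (Bool; true; false; _∧_; _∨_; not; if_then_else_)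
import Data.Bool as Bool
open import Data.Bool.Properties using (∧-conicalˡ; ∧-conicalʳ; ∨-conicalˡ; ∨-conicalʳ; ∨-zeroʳ; T-≡; not-injective)
open import Data.Bool.ListAction using (any)
open import Data.Empty using (⊥; ⊥-elim)
open import Data.Fin using (Fin; zero; suc; combine; remQuot; _↑ˡ_; _↑ʳ_; fromℕ<; _≟_)
open import Data.Fin.Properties using (suc-injective; remQuot-combine; combine-remQuot; combine-injectiveˡ; combine-injectiveʳ)
open import Data.Fin.Subset using (Subset; ∣_∣; _∩_; _∈_)
open import Data.Fin.Subset.Properties using (anySubset?)
open import Data.List using (allFin)
open import Data.List.Relation.Unary.Any as Any using (satisfied)
open import Data.List.Relation.Unary.Any.Properties using (any⁺; any⁻)
open import Data.List.Membership.Propositional.Properties using (∈-allFin)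
open import Data.Vec using (tabulate; lookup; count)
import Data.Vec.Functional as Vector
open import Data.Vec.Properties using (lookup∘tabulate; tabulate∘lookup; lookup-zipWith; lookup⇒[]=; []=⇒lookup)
open import Data.Product using (Σ-syntax; ∃; _×_; _,_; proj₁; proj₂)
open import Data.Sum using (_⊎_; inj₁; inj₂)
open import Function using (_∘_)
open import Function.Bundles using (_⇔_; mk⇔; Equivalence)
open import Relation.Nullary using (¬_; Dec; yes; no; contradiction)
open import Relation.Nullary.Decidable using (⌊_⌋; _×-dec_)
open import Relation.Binary.PropositionalEquality

open Equivalence using (to; from)

-- Finite sets as boolean predicates

true≢false : ∀ {a} → a ≡ true → a ≡ false → ⊥
true≢false refl ()

∧-intro : ∀ {a b} → a ≡ true → b ≡ true → a ∧ b ≡ true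
∧-intro refl refl = refl

∨-introˡ : ∀ {a} b → a ≡ true → a ∨ b ≡ true
∨-introˡ b refl = refl

∨-introʳ : ∀ a {b} → b ≡ true → a ∨ b ≡ true
∨-introʳ a refl = ∨-zeroʳ a

∨-elim : ∀ a {b} → a ∨ b ≡ true → a ≡ true ⊎ b ≡ true
∨-elim true  _ = inj₁ refl
∨-elim false e = inj₂ e

opaque
  _≡ᵇ_ : ∀ {n} → Fin n → Fin n → Bool
  x ≡ᵇ y = ⌊ x ≟ y ⌋

  ≡ᵇ-refl : ∀ {n} (x : Fin n) → x ≡ᵇ x ≡ true
  ≡ᵇ-refl x with x ≟ x
  ... | yes _   = refl
  ... | no  x≢x = contradiction refl x≢x

  ≡ᵇ-suc : ∀ {n} (x y : Fin n) → (suc x ≡ᵇ suc y) ≡ (x ≡ᵇ y)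
  ≡ᵇ-suc x y with x ≟ y
  ... | yes _ = refl
  ... | no  _ = refl

  ≡ᵇ⇒≡ : ∀ {n} {x y : Fin n} → x ≡ᵇ y ≡ true → x ≡ y
  ≡ᵇ⇒≡ {x = x} {y} e with x ≟ y
  ... | yes x≡y = x≡y

infix 4 _⊆ᵇ_

_⊆ᵇ_ : ∀ {n} → (Fin n → Bool) → (Fin n → Bool) → Set
p ⊆ᵇ q = ∀ x → p x ≡ true → q x ≡ true

⊆ᵇ⇒∧≡ : ∀ {n} {p q : Fin n → Bool} → p ⊆ᵇ q → ∀ x → p x ∧ q x ≡ p x
⊆ᵇ⇒∧≡ {p = p} p⊆q x with p x in px
... | true  = p⊆q x px
... | false = refl

≡ᵇ-⊆ : ∀ {n} {p : Fin n → Bool} {y} → p y ≡ true → (_≡ᵇ y) ⊆ᵇ p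
≡ᵇ-⊆ {p = p} py x x≡y = subst (λ z → p z ≡ true) (sym (≡ᵇ⇒≡ x≡y)) py

InjectiveOn : ∀ {a b} → (Fin a → Bool) → (Fin a → Fin b) → Set
InjectiveOn L f = ∀ x y → L x ≡ true → L y ≡ true → f x ≡ f y → x ≡ y

InjectiveOn-suc : ∀ {a b} {L : Fin (suc a) → Bool} {f : Fin (suc a) → Fin b} →
                  InjectiveOn L f → InjectiveOn (L ∘ suc) (f ∘ suc)
InjectiveOn-suc inj x y Lx Ly fx≡fy = suc-injective (inj (suc x) (suc y) Lx Ly fx≡fy)

∣_∣ᵇ : ∀ {n} → (Fin n → Bool) → ℕ
∣_∣ᵇ {zero}  p = 0
∣_∣ᵇ {suc n} p = if p zero then suc ∣ p ∘ suc ∣ᵇ else ∣ p ∘ suc ∣ᵇ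

∣∣ᵇ-mono : ∀ {n} {p q : Fin n → Bool} → p ⊆ᵇ q → ∣ p ∣ᵇ ≤ ∣ q ∣ᵇ
∣∣ᵇ-mono {zero} _ = z≤n
∣∣ᵇ-mono {suc n} {p} {q} p⊆q with p zero in p₀ | q zero in q₀
... | true  | true  = s≤s (∣∣ᵇ-mono (p⊆q ∘ suc))
... | true  | false = ⊥-elim (true≢false (p⊆q zero p₀) q₀)
... | false | true  = m≤n⇒m≤1+n (∣∣ᵇ-mono (p⊆q ∘ suc))
... | false | false = ∣∣ᵇ-mono (p⊆q ∘ suc)

∣∣ᵇ-cong : ∀ {n} {p q : Fin n → Bool} → (∀ x → p x ≡ q x) → ∣ p ∣ᵇ ≡ ∣ q ∣ᵇ
∣∣ᵇ-cong p≗q = ≤-antisym (∣∣ᵇ-mono (λ x → trans (sym (p≗q x))))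
                         (∣∣ᵇ-mono (λ x → trans (p≗q x)))

∣∣ᵇ≤n : ∀ {n} (p : Fin n → Bool) → ∣ p ∣ᵇ ≤ n
∣∣ᵇ≤n {zero}  p = z≤n
∣∣ᵇ≤n {suc n} p with p zero
... | true  = s≤s (∣∣ᵇ≤n (p ∘ suc))
... | false = m≤n⇒m≤1+n (∣∣ᵇ≤n (p ∘ suc))

∣true∣ᵇ≡n : ∀ n → ∣ (λ (_ : Fin n) → true) ∣ᵇ ≡ n
∣true∣ᵇ≡n zero    = refl
∣true∣ᵇ≡n (suc n) = cong suc (∣true∣ᵇ≡n n)

∣false∣ᵇ≡0 : ∀ n → ∣ (λ (_ : Fin n) → false) ∣ᵇ ≡ 0
∣false∣ᵇ≡0 zero    = refl
∣false∣ᵇ≡0 (suc n) = ∣false∣ᵇ≡0 n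

∈⇒∣∣ᵇ>0 : ∀ {n} (p : Fin n → Bool) x → p x ≡ true → 0 < ∣ p ∣ᵇ
∈⇒∣∣ᵇ>0 p zero    px rewrite px = s≤s z≤n
∈⇒∣∣ᵇ>0 p (suc x) px with p zero
... | true  = s≤s z≤n
... | false = ∈⇒∣∣ᵇ>0 (p ∘ suc) x px

∣∣ᵇ>0⇒∈ : ∀ {n} (p : Fin n → Bool) → 0 < ∣ p ∣ᵇ → Σ[ x ∈ Fin n ] p x ≡ true
∣∣ᵇ>0⇒∈ {suc n} p |p|>0 with p zero in p₀
... | true  = zero , p₀
... | false with ∣∣ᵇ>0⇒∈ (p ∘ suc) |p|>0
...   | x , px = suc x , px

opaque
  unfolding _≡ᵇ_

  ∣∣ᵇ-remove : ∀ {n} (p : Fin n → Bool) y → p y ≡ true →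
               suc ∣ (λ x → not (x ≡ᵇ y) ∧ p x) ∣ᵇ ≡ ∣ p ∣ᵇ
  ∣∣ᵇ-remove {suc n} p zero    py rewrite py = refl
  ∣∣ᵇ-remove {suc n} p (suc y) py
    with p zero | trans (cong suc (∣∣ᵇ-cong λ x → cong (λ b → not b ∧ p (suc x)) (≡ᵇ-suc x y)))
                        (∣∣ᵇ-remove (p ∘ suc) y py)
  ... | true  | tail = cong suc tail
  ... | false | tail = tail

∣singleton∣ᵇ≡1 : ∀ {n} (y : Fin n) → ∣ (_≡ᵇ y) ∣ᵇ ≡ 1
∣singleton∣ᵇ≡1 {n} y = begin
  ∣ (_≡ᵇ y) ∣ᵇ                                 ≡⟨ ∣∣ᵇ-remove (_≡ᵇ y) y (≡ᵇ-refl y) ⟨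
  suc ∣ (λ x → not (x ≡ᵇ y) ∧ (x ≡ᵇ y)) ∣ᵇ     ≡⟨ cong suc (∣∣ᵇ-cong (λ x → contradictory (x ≡ᵇ y))) ⟩
  suc ∣ (λ (_ : Fin n) → false) ∣ᵇ             ≡⟨ cong suc (∣false∣ᵇ≡0 n) ⟩
  1                                            ∎
  where
  open ≡-Reasoning
  contradictory : ∀ b → not b ∧ b ≡ false
  contradictory true  = refl
  contradictory false = refl

∣∣ᵇ-injection : ∀ {a b} (p : Fin a → Bool) (q : Fin b → Bool) (f : Fin a → Fin b) →
                (∀ x → p x ≡ true → q (f x) ≡ true) → InjectiveOn p f → ∣ p ∣ᵇ ≤ ∣ q ∣ᵇ
∣∣ᵇ-injection {zero}  p q f _    _   = z≤n
∣∣ᵇ-injection {suc a} p q f maps inj with p zero in p₀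
... | false = ∣∣ᵇ-injection (p ∘ suc) q (f ∘ suc) (maps ∘ suc) (InjectiveOn-suc inj)
... | true  = ≤-trans (s≤s (∣∣ᵇ-injection (p ∘ suc) q′ (f ∘ suc) maps′ (InjectiveOn-suc inj)))
                      (≤-reflexive (∣∣ᵇ-remove q (f zero) (maps zero p₀)))
  where
  q′ : Fin _ → Bool
  q′ z = not (z ≡ᵇ f zero) ∧ q z
  maps′ : ∀ x → p (suc x) ≡ true → q′ (f (suc x)) ≡ true
  maps′ x px with f (suc x) ≡ᵇ f zero in e
  ... | true  with () ← inj (suc x) zero px p₀ (≡ᵇ⇒≡ e)
  ... | false = maps (suc x) px

∣∪∣ᵇ+∣∩∣ᵇ : ∀ {n} (p q : Fin n → Bool) →
            ∣ (λ x → p x ∨ q x) ∣ᵇ + ∣ (λ x → p x ∧ q x) ∣ᵇ ≡ ∣ p ∣ᵇ + ∣ q ∣ᵇ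
∣∪∣ᵇ+∣∩∣ᵇ {zero}  p q = refl
∣∪∣ᵇ+∣∩∣ᵇ {suc n} p q with p zero | q zero | ∣∪∣ᵇ+∣∩∣ᵇ (p ∘ suc) (q ∘ suc)
... | true  | true  | ih = cong suc (trans (+-suc _ _) (trans (cong suc ih) (sym (+-suc _ _))))
... | true  | false | ih = cong suc ih
... | false | true  | ih = trans (cong suc ih) (sym (+-suc _ _))
... | false | false | ih = ih

∣∪∣ᵇ≤ : ∀ {n} (p q : Fin n → Bool) → ∣ (λ x → p x ∨ q x) ∣ᵇ ≤ ∣ p ∣ᵇ + ∣ q ∣ᵇ
∣∪∣ᵇ≤ p q = ≤-trans (m≤m+n _ _) (≤-reflexive (∣∪∣ᵇ+∣∩∣ᵇ p q))

∣∩∣ᵇ+∣∖∣ᵇ : ∀ {n} (p q : Fin n → Bool) →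
            ∣ (λ x → p x ∧ q x) ∣ᵇ + ∣ (λ x → p x ∧ not (q x)) ∣ᵇ ≡ ∣ p ∣ᵇ
∣∩∣ᵇ+∣∖∣ᵇ {zero}  p q = refl
∣∩∣ᵇ+∣∖∣ᵇ {suc n} p q with p zero | q zero | ∣∩∣ᵇ+∣∖∣ᵇ (p ∘ suc) (q ∘ suc)
... | true  | true  | ih = cong suc ih
... | true  | false | ih = trans (+-suc _ _) (cong suc ih)
... | false | _     | ih = ih

∣∣ᵇ+∣not∣ᵇ≡n : ∀ {n} (p : Fin n → Bool) → ∣ p ∣ᵇ + ∣ not ∘ p ∣ᵇ ≡ n
∣∣ᵇ+∣not∣ᵇ≡n {n} p = trans (∣∩∣ᵇ+∣∖∣ᵇ (λ _ → true) p) (∣true∣ᵇ≡n n)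

superset-of-size : ∀ {m} (p : Fin m → Bool) k → ∣ p ∣ᵇ ≤ k → k ≤ m →
                   Σ[ q ∈ (Fin m → Bool) ] p ⊆ᵇ q × ∣ q ∣ᵇ ≡ k
superset-of-size {zero}  p zero _ _ = p , (λ _ px → px) , refl
superset-of-size {suc m} p k |p|≤k k≤1+m with p zero in p₀ | k
... | true  | zero   with () ← |p|≤k
... | true  | suc k′
  with q , p⊆q , |q|≡k′ ← superset-of-size (p ∘ suc) k′ (≤-pred |p|≤k) (≤-pred k≤1+m) =
  (true Vector.∷ q) , (λ { zero _ → refl ; (suc x) → p⊆q x }) , cong suc |q|≡k′
... | false | k′ with k′ ≤? m
...   | yes k′≤m with q , p⊆q , |q|≡k′ ← superset-of-size (p ∘ suc) k′ |p|≤k k′≤m =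
  (false Vector.∷ q) , (λ { zero p0 → ⊥-elim (true≢false p0 p₀) ; (suc x) → p⊆q x }) , |q|≡k′
...   | no  k′≰m =
  (λ _ → true) , (λ _ _ → refl) , trans (∣true∣ᵇ≡n (suc m)) (≤-antisym (≰⇒> k′≰m) k≤1+m)

anyFin : ∀ {n} → (Fin n → Bool) → Bool
anyFin p = any p (allFin _)

anyFin-intro : ∀ {n} (p : Fin n → Bool) x → p x ≡ true → anyFin p ≡ true
anyFin-intro {n} p x px =
  to T-≡ (any⁺ {xs = allFin n} p (Any.map (λ { refl → from T-≡ px }) (∈-allFin x)))

anyFin-elim : ∀ {n} (p : Fin n → Bool) → anyFin p ≡ true → Σ[ x ∈ Fin n ] p x ≡ true
anyFin-elim {n} p e with x , px ← satisfied (any⁻ p (allFin n) (from T-≡ e)) = x , to T-≡ px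

-- Hall's theorem

-- Opaque, so that adj and X can be inferred from neighbours adj X y.
opaque
  neighbours : ∀ {a b} → (Fin a → Fin b → Bool) → (Fin a → Bool) → Fin b → Bool
  neighbours adj X y = anyFin λ x → X x ∧ adj x y

  neighbours-intro : ∀ {a b} {adj : Fin a → Fin b → Bool} {X : Fin a → Bool} {y} x →
                     X x ≡ true → adj x y ≡ true → neighbours adj X y ≡ true
  neighbours-intro x Xx adjxy = anyFin-intro _ x (∧-intro Xx adjxy)

  neighbours-elim : ∀ {a b} {adj : Fin a → Fin b → Bool} {X : Fin a → Bool} {y} →
                    neighbours adj X y ≡ true → Σ[ x ∈ Fin a ] X x ≡ true × adj x y ≡ true
  neighbours-elim {X = X} y∈N with x , Xx∧adj ← anyFin-elim _ y∈N =
    x , ∧-conicalˡ (X x) _ Xx∧adj , ∧-conicalʳ (X x) _ Xx∧adj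

neighbours-mono : ∀ {a b} {adj adj′ : Fin a → Fin b → Bool} {X Y : Fin a → Bool} →
                  (∀ x y → X x ≡ true → adj x y ≡ true → adj′ x y ≡ true) → X ⊆ᵇ Y →
                  neighbours adj X ⊆ᵇ neighbours adj′ Y
neighbours-mono adj⇒adj′ X⊆Y y y∈NX with x , Xx , adjxy ← neighbours-elim y∈NX =
  neighbours-intro x (X⊆Y x Xx) (adj⇒adj′ x y Xx adjxy)

module _ {a b : ℕ} where

  HallCondition : (Fin a → Fin b → Bool) → (Fin a → Bool) → Set
  HallCondition adj L = ∀ X → X ⊆ᵇ L → ∣ X ∣ᵇ ≤ ∣ neighbours adj X ∣ᵇ

  record Matching (adj : Fin a → Fin b → Bool) (L : Fin a → Bool) : Set where
    constructor matching
    field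
      mate          : Fin a → Fin b
      mate-adjacent : ∀ x → L x ≡ true → adj x (mate x) ≡ true
      mate-injective : InjectiveOn L mate

  Expanding : (Fin a → Fin b → Bool) → (Fin a → Bool) → Set
  Expanding adj L = ∀ X → X ⊆ᵇ L → 0 < ∣ X ∣ᵇ → ∣ X ∣ᵇ < ∣ L ∣ᵇ → ∣ X ∣ᵇ < ∣ neighbours adj X ∣ᵇ

  -- A tight set is given by a subset V of the whole side, intersected with L,
  -- so that its existence is decidable by enumerating all V.
  Tight : (Fin a → Fin b → Bool) → (Fin a → Bool) → Subset a → Set
  Tight adj L V = 0 < ∣ X ∣ᵇ × ∣ X ∣ᵇ < ∣ L ∣ᵇ × ∣ neighbours adj X ∣ᵇ ≤ ∣ X ∣ᵇ
    where X = λ x → lookup V x ∧ L x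

  tight? : ∀ adj L V → Dec (Tight adj L V)
  tight? adj L V = (0 <? ∣ X ∣ᵇ) ×-dec (∣ X ∣ᵇ <? ∣ L ∣ᵇ) ×-dec (∣ neighbours adj X ∣ᵇ ≤? ∣ X ∣ᵇ)
    where X = λ x → lookup V x ∧ L x

  ¬tight⇒expanding : ∀ {adj L} → ¬ ∃ (Tight adj L) → Expanding adj L
  ¬tight⇒expanding {adj} {L} ¬tight X X⊆L 0<|X| |X|<|L| = begin-strict
    ∣ X ∣ᵇ                   ≡⟨ |X′|≡|X| ⟨
    ∣ X′ ∣ᵇ                  <⟨ ≰⇒> (λ |NX′|≤|X′| → ¬tight (V , 0<|X′| , |X′|<|L| , |NX′|≤|X′|)) ⟩
    ∣ neighbours adj X′ ∣ᵇ   ≤⟨ ∣∣ᵇ-mono (neighbours-mono {adj = adj} (λ _ _ _ e → e) X′⊆X) ⟩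
    ∣ neighbours adj X ∣ᵇ    ∎
    where
    open ≤-Reasoning
    V = tabulate X
    X′ = λ x → lookup V x ∧ L x
    X′≗X : ∀ x → X′ x ≡ X x
    X′≗X x rewrite lookup∘tabulate X x = ⊆ᵇ⇒∧≡ X⊆L x
    X′⊆X : X′ ⊆ᵇ X
    X′⊆X x = trans (sym (X′≗X x))
    |X′|≡|X| : ∣ X′ ∣ᵇ ≡ ∣ X ∣ᵇ
    |X′|≡|X| = ∣∣ᵇ-cong X′≗X
    0<|X′| = subst (0 <_) (sym |X′|≡|X|) 0<|X|
    |X′|<|L| = subst (_< ∣ L ∣ᵇ) (sym |X′|≡|X|) |X|<|L|

  hallCondition-restrict : ∀ {adj L} X → HallCondition adj L → X ⊆ᵇ L →
                           HallCondition (λ x y → adj x y ∧ neighbours adj X y) X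
  hallCondition-restrict {adj} X hc X⊆L Y Y⊆X =
    ≤-trans (hc Y (λ x → X⊆L x ∘ Y⊆X x))
            (∣∣ᵇ-mono (neighbours-mono {adj = adj} {adj′ = λ x y → adj x y ∧ neighbours adj X y}
                                       (λ x y Yx adjxy →
              ∧-intro adjxy (neighbours-intro x (Y⊆X x Yx) adjxy)) (λ _ e → e)))

  hallCondition-contract : ∀ {adj L} X → HallCondition adj L → X ⊆ᵇ L →
                           ∣ neighbours adj X ∣ᵇ ≤ ∣ X ∣ᵇ →
                           HallCondition (λ x y → adj x y ∧ not (neighbours adj X y))
                                         (λ x → L x ∧ not (X x))
  hallCondition-contract {adj} {L} X hc X⊆L |NX|≤|X| Y Y⊆L∖X =
    +-cancelʳ-≤ ∣ X ∣ᵇ _ _ (begin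
      ∣ Y ∣ᵇ + ∣ X ∣ᵇ                                    ≡⟨ |Y∪X|≡ ⟨
      ∣ Y∪X ∣ᵇ                                           ≤⟨ hc Y∪X Y∪X⊆L ⟩
      ∣ neighbours adj Y∪X ∣ᵇ                            ≤⟨ ∣∣ᵇ-mono N[Y∪X]⊆ ⟩
      ∣ (λ y → neighbours adj∖NX Y y ∨ neighbours adj X y) ∣ᵇ ≤⟨ ∣∪∣ᵇ≤ (neighbours adj∖NX Y) _ ⟩
      ∣ neighbours adj∖NX Y ∣ᵇ + ∣ neighbours adj X ∣ᵇ   ≤⟨ +-monoʳ-≤ _ |NX|≤|X| ⟩
      ∣ neighbours adj∖NX Y ∣ᵇ + ∣ X ∣ᵇ                  ∎)
    where
    open ≤-Reasoning
    adj∖NX = λ x y → adj x y ∧ not (neighbours adj X y)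
    Y∪X = λ x → Y x ∨ X x
    Y∪X⊆L : Y∪X ⊆ᵇ L
    Y∪X⊆L x e with ∨-elim (Y x) e
    ... | inj₁ Yx = ∧-conicalˡ _ _ (Y⊆L∖X x Yx)
    ... | inj₂ Xx = X⊆L x Xx
    disjoint : ∀ x → Y x ∧ X x ≡ false
    disjoint x with Y x in Yx
    ... | true  = not-injective (∧-conicalʳ (L x) _ (Y⊆L∖X x Yx))
    ... | false = refl
    |Y∪X|≡ : ∣ Y∪X ∣ᵇ ≡ ∣ Y ∣ᵇ + ∣ X ∣ᵇ
    |Y∪X|≡ = begin-equality
      ∣ Y∪X ∣ᵇ                                ≡⟨ +-identityʳ _ ⟨
      ∣ Y∪X ∣ᵇ + 0                            ≡⟨ cong (∣ Y∪X ∣ᵇ +_) (trans (∣∣ᵇ-cong disjoint) (∣false∣ᵇ≡0 a)) ⟨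
      ∣ Y∪X ∣ᵇ + ∣ (λ x → Y x ∧ X x) ∣ᵇ       ≡⟨ ∣∪∣ᵇ+∣∩∣ᵇ Y X ⟩
      ∣ Y ∣ᵇ + ∣ X ∣ᵇ                         ∎
    N[Y∪X]⊆ : neighbours adj Y∪X ⊆ᵇ (λ y → neighbours adj∖NX Y y ∨ neighbours adj X y)
    N[Y∪X]⊆ y y∈N with x , Y∪Xx , adjxy ← neighbours-elim y∈N with ∨-elim (Y x) Y∪Xx
    ... | inj₂ Xx = ∨-introʳ _ (neighbours-intro x Xx adjxy)
    ... | inj₁ Yx with neighbours adj X y in NXy
    ...   | true  = ∨-zeroʳ _
    ...   | false = ∨-introˡ false (neighbours-intro x Yx (∧-intro adjxy (cong not NXy)))

  hallCondition-delete : ∀ {adj L x₀} y₀ → Expanding adj L → L x₀ ≡ true →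
                         HallCondition (λ x y → adj x y ∧ not (y ≡ᵇ y₀)) (λ x → not (x ≡ᵇ x₀) ∧ L x)
  hallCondition-delete {adj} {L} {x₀} y₀ expanding Lx₀ Y Y⊆L′ with 0 <? ∣ Y ∣ᵇ
  ... | no  |Y|≯0 = ≤-trans (≮⇒≥ |Y|≯0) z≤n
  ... | yes 0<|Y| = ≤-pred (begin-strict
    ∣ Y ∣ᵇ                                          <⟨ expanding Y Y⊆L 0<|Y| |Y|<|L| ⟩
    ∣ neighbours adj Y ∣ᵇ                           ≤⟨ ∣∣ᵇ-mono N⊆ ⟩
    ∣ (λ y → (y ≡ᵇ y₀) ∨ neighbours adj′ Y y) ∣ᵇ    ≤⟨ ∣∪∣ᵇ≤ (_≡ᵇ y₀) _ ⟩
    ∣ (_≡ᵇ y₀) ∣ᵇ + ∣ neighbours adj′ Y ∣ᵇ          ≡⟨ cong (_+ ∣ neighbours adj′ Y ∣ᵇ) (∣singleton∣ᵇ≡1 y₀) ⟩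
    suc ∣ neighbours adj′ Y ∣ᵇ                      ∎)
    where
    open ≤-Reasoning
    adj′ : Fin a → Fin b → Bool
    adj′ x y = adj x y ∧ not (y ≡ᵇ y₀)
    Y⊆L : Y ⊆ᵇ L
    Y⊆L x Yx = ∧-conicalʳ (not (x ≡ᵇ x₀)) _ (Y⊆L′ x Yx)
    |Y|<|L| : ∣ Y ∣ᵇ < ∣ L ∣ᵇ
    |Y|<|L| = <-≤-trans (s≤s (∣∣ᵇ-mono Y⊆L′)) (≤-reflexive (∣∣ᵇ-remove L x₀ Lx₀))
    N⊆ : neighbours adj Y ⊆ᵇ (λ y → (y ≡ᵇ y₀) ∨ neighbours adj′ Y y)
    N⊆ y y∈N with y ≡ᵇ y₀ in y≢y₀
    ... | true  = refl
    ... | false with x , Yx , adjxy ← neighbours-elim y∈N =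
      neighbours-intro x Yx (∧-intro adjxy (cong not y≢y₀))

  hallCondition⇒neighbour : ∀ {adj L x₀} → HallCondition adj L → L x₀ ≡ true →
                            Σ[ y ∈ Fin b ] adj x₀ y ≡ true
  hallCondition⇒neighbour {adj} {x₀ = x₀} hc Lx₀
    with y , y∈N ← ∣∣ᵇ>0⇒∈ (neighbours adj (_≡ᵇ x₀))
                     (subst (_≤ ∣ neighbours adj (_≡ᵇ x₀) ∣ᵇ) (∣singleton∣ᵇ≡1 x₀) (hc (_≡ᵇ x₀) (≡ᵇ-⊆ Lx₀)))
    with x , x≡x₀ , adjxy ← neighbours-elim {adj = adj} y∈N
    = y , subst (λ x → adj x y ≡ true) (≡ᵇ⇒≡ x≡x₀) adjxy

  -- A matching is a total map, so an empty L still needs some vertex of Fin b.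
  matching-∅ : ∀ {adj L} → Fin b → ∣ L ∣ᵇ ≤ 0 → Matching adj L
  matching-∅ {L = L} y |L|≤0 =
    matching (λ _ → y) (λ x Lx → ⊥-elim (L∅ x Lx)) (λ x _ Lx _ _ → ⊥-elim (L∅ x Lx))
    where
    L∅ : ∀ x → L x ≡ true → ⊥
    L∅ x Lx = <⇒≱ (∈⇒∣∣ᵇ>0 L x Lx) |L|≤0

  matching-singleton : ∀ {adj : Fin a → Fin b → Bool} {x₀ y₀} → adj x₀ y₀ ≡ true →
                       Matching (λ x y → adj x y ∧ (y ≡ᵇ y₀)) (_≡ᵇ x₀)
  matching-singleton {adj} {x₀} {y₀} adjx₀y₀ = matching (λ _ → y₀) adjacent injective
    where
    adjacent : ∀ x → x ≡ᵇ x₀ ≡ true → adj x y₀ ∧ (y₀ ≡ᵇ y₀) ≡ true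
    adjacent x x≡x₀ =
      ∧-intro (subst (λ z → adj z y₀ ≡ true) (sym (≡ᵇ⇒≡ x≡x₀)) adjx₀y₀) (≡ᵇ-refl y₀)
    injective : InjectiveOn (_≡ᵇ x₀) (λ _ → y₀)
    injective x y x≡x₀ y≡x₀ _ = trans (≡ᵇ⇒≡ x≡x₀) (sym (≡ᵇ⇒≡ y≡x₀))

  -- Z separates the images of the two parts, so the glued map is injective.
  matching-glue : ∀ {adj L L₁ L₂} (X : Fin a → Bool) (Z : Fin b → Bool) →
                  (∀ x → L x ≡ true → X x ≡ true → L₁ x ≡ true) →
                  (∀ x → L x ≡ true → X x ≡ false → L₂ x ≡ true) →
                  Matching (λ x y → adj x y ∧ Z y) L₁ →
                  Matching (λ x y → adj x y ∧ not (Z y)) L₂ →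
                  Matching adj L
  matching-glue {adj} {L} {L₁} {L₂} X Z L→L₁ L→L₂
                (matching f₁ adj₁ injective₁) (matching f₂ adj₂ injective₂) =
    matching f adjacent injective
    where
    f : Fin a → Fin b
    f x = if X x then f₁ x else f₂ x
    adjacent : ∀ x → L x ≡ true → adj x (f x) ≡ true
    adjacent x Lx with X x in Xx
    ... | true  = ∧-conicalˡ (adj x (f₁ x)) _ (adj₁ x (L→L₁ x Lx Xx))
    ... | false = ∧-conicalˡ (adj x (f₂ x)) _ (adj₂ x (L→L₂ x Lx Xx))
    separated : ∀ x y → L₁ x ≡ true → L₂ y ≡ true → f₁ x ≢ f₂ y
    separated x y L₁x L₂y f₁x≡f₂y =
      true≢false (subst (λ z → Z z ≡ true) f₁x≡f₂y (∧-conicalʳ (adj x (f₁ x)) _ (adj₁ x L₁x)))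
                 (not-injective (∧-conicalʳ (adj y (f₂ y)) _ (adj₂ y L₂y)))
    injective : InjectiveOn L f
    injective x y Lx Ly fx≡fy with X x in Xx | X y in Xy
    ... | true  | true  = injective₁ x y (L→L₁ x Lx Xx) (L→L₁ y Ly Xy) fx≡fy
    ... | false | false = injective₂ x y (L→L₂ x Lx Xx) (L→L₂ y Ly Xy) fx≡fy
    ... | true  | false = ⊥-elim (separated x y (L→L₁ x Lx Xx) (L→L₂ y Ly Xy) fx≡fy)
    ... | false | true  = ⊥-elim (separated y x (L→L₁ y Ly Xy) (L→L₂ x Lx Xx) (sym fx≡fy))

  module _ {n : ℕ} (hall< : ∀ {adj L} → ∣ L ∣ᵇ ≤ n → HallCondition adj L → Matching adj L) where

    matching-tight : ∀ {adj L} V → Tight adj L V → HallCondition adj L → ∣ L ∣ᵇ ≤ suc n →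
                     Matching adj L
    matching-tight {adj} {L} V (0<|X| , |X|<|L| , |NX|≤|X|) hc |L|≤1+n =
      matching-glue X (neighbours adj X) (λ _ _ Xx → Xx) (λ x Lx Xx → ∧-intro Lx (cong not Xx))
        (hall< (≤-pred (<-≤-trans |X|<|L| |L|≤1+n)) (hallCondition-restrict X hc X⊆L))
        (hall< (≤-pred (<-≤-trans |L∖X|<|L| |L|≤1+n)) (hallCondition-contract X hc X⊆L |NX|≤|X|))
      where
      X : Fin a → Bool
      X x = lookup V x ∧ L x
      X⊆L : X ⊆ᵇ L
      X⊆L x = ∧-conicalʳ (lookup V x) _
      |L∖X|<|L| : ∣ (λ x → L x ∧ not (X x)) ∣ᵇ < ∣ L ∣ᵇ
      |L∖X|<|L| = begin-strict
        ∣ (λ x → L x ∧ not (X x)) ∣ᵇ                                  <⟨ m<n+m _ (<-≤-trans 0<|X| (∣∣ᵇ-mono X⊆L∩X)) ⟩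
        ∣ (λ x → L x ∧ X x) ∣ᵇ + ∣ (λ x → L x ∧ not (X x)) ∣ᵇ         ≡⟨ ∣∩∣ᵇ+∣∖∣ᵇ L X ⟩
        ∣ L ∣ᵇ                                                        ∎
        where
        open ≤-Reasoning
        X⊆L∩X : X ⊆ᵇ (λ x → L x ∧ X x)
        X⊆L∩X x Xx = ∧-intro (X⊆L x Xx) Xx

    matching-expanding : ∀ {adj L} → Expanding adj L → HallCondition adj L → 0 < ∣ L ∣ᵇ →
                         ∣ L ∣ᵇ ≤ suc n → Matching adj L
    matching-expanding {adj} {L} expanding hc 0<|L| |L|≤1+n
      with x₀ , Lx₀ ← ∣∣ᵇ>0⇒∈ L 0<|L|
      with y₀ , adjx₀y₀ ← hallCondition⇒neighbour hc Lx₀ =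
      matching-glue (_≡ᵇ x₀) (_≡ᵇ y₀) (λ _ _ x≡x₀ → x≡x₀) (λ x Lx x≢x₀ → ∧-intro (cong not x≢x₀) Lx)
        (matching-singleton {adj = adj} adjx₀y₀)
        (hall< |L′|≤n (hallCondition-delete y₀ expanding Lx₀))
      where
      |L′|≤n : ∣ (λ x → not (x ≡ᵇ x₀) ∧ L x) ∣ᵇ ≤ n
      |L′|≤n = ≤-pred (≤-trans (≤-reflexive (∣∣ᵇ-remove L x₀ Lx₀)) |L|≤1+n)

  -- Induction on |L|: split L along a tight set if there is one, otherwise match one
  -- edge and delete its two ends.
  hall≤ : ∀ {adj L} → Fin b → ∀ n → ∣ L ∣ᵇ ≤ n → HallCondition adj L → Matching adj L
  hall≤ y zero    |L|≤0 _ = matching-∅ y |L|≤0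
  hall≤ {adj} {L} y (suc n) |L|≤1+n hc with anySubset? (tight? adj L) | 0 <? ∣ L ∣ᵇ
  ... | yes (V , tight) | _         = matching-tight (hall≤ y n) V tight hc |L|≤1+n
  ... | no ¬tight       | yes 0<|L| =
    matching-expanding (hall≤ y n) (¬tight⇒expanding ¬tight) hc 0<|L| |L|≤1+n
  ... | no _            | no |L|≯0  = matching-∅ y (≮⇒≥ |L|≯0)

  hall : ∀ {adj L} → Fin b → HallCondition adj L → Matching adj L
  hall {L = L} y = hall≤ y ∣ L ∣ᵇ ≤-refl

-- Private neighbours

∣∣ᵇ-++ : ∀ a {b} (p : Fin (a + b) → Bool) → ∣ p ∣ᵇ ≡ ∣ p ∘ (_↑ˡ b) ∣ᵇ + ∣ p ∘ (a ↑ʳ_) ∣ᵇ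
∣∣ᵇ-++ zero    p = refl
∣∣ᵇ-++ (suc a) p with p zero
... | true  = cong suc (∣∣ᵇ-++ a (p ∘ suc))
... | false = ∣∣ᵇ-++ a (p ∘ suc)

owners : ∀ m h → (Fin (m * h) → Bool) → Fin m → Bool
owners m h X u = anyFin λ (c : Fin h) → X (combine u c)

∣∣ᵇ≤∣owners∣ᵇ*h : ∀ m h (X : Fin (m * h) → Bool) → ∣ X ∣ᵇ ≤ ∣ owners m h X ∣ᵇ * h
∣∣ᵇ≤∣owners∣ᵇ*h zero    h X = z≤n
∣∣ᵇ≤∣owners∣ᵇ*h (suc m) h X rewrite ∣∣ᵇ-++ h {m * h} X with owners (suc m) h X zero in X₀
... | true  = +-mono-≤ (∣∣ᵇ≤n (X ∘ (_↑ˡ m * h))) (∣∣ᵇ≤∣owners∣ᵇ*h m h (X ∘ (h ↑ʳ_)))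
... | false = +-mono-≤ (≤-trans (∣∣ᵇ-mono none) (≤-reflexive (∣false∣ᵇ≡0 h)))
                       (∣∣ᵇ≤∣owners∣ᵇ*h m h (X ∘ (h ↑ʳ_)))
  where
  none : X ∘ (_↑ˡ m * h) ⊆ᵇ (λ _ → false)
  none c Xc = ⊥-elim (true≢false (anyFin-intro (X ∘ (_↑ˡ m * h)) c Xc) X₀)

record PrivateNeighbours {m b} (adj : Fin m → Fin b → Bool) (R : Fin m → Bool) (h : ℕ) : Set where
  field
    π            : Fin m → Fin h → Fin b
    π-adjacent   : ∀ u c → R u ≡ true → adj u (π u c) ≡ true
    π-injective  : ∀ u v c d → R u ≡ true → R v ≡ true → π u c ≡ π v d → u ≡ v × c ≡ d

-- Hall's theorem for the graph in which every u ∈ R is replaced by h copies of itself.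
privateNeighbours : ∀ {m b} {adj : Fin m → Fin b → Bool} {R : Fin m → Bool} h → Fin b →
                    (∀ P → P ⊆ᵇ R → ∣ P ∣ᵇ * h ≤ ∣ neighbours adj P ∣ᵇ) →
                    PrivateNeighbours adj R h
privateNeighbours {m} {b} {adj} {R} h y expansion =
  record { π = π ; π-adjacent = π-adjacent ; π-injective = π-injective }
  where
  owner : Fin (m * h) → Fin m
  owner x = proj₁ (remQuot h x)
  owner-combine : ∀ u c → owner (combine u c) ≡ u
  owner-combine u c = cong proj₁ (remQuot-combine u c)
  copy-adj : Fin (m * h) → Fin b → Bool
  copy-adj x = adj (owner x)
  copy-R : Fin (m * h) → Bool
  copy-R x = R (owner x)
  copy-R-combine : ∀ u c → R u ≡ true → copy-R (combine u c) ≡ true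
  copy-R-combine u c = subst (λ z → R z ≡ true) (sym (owner-combine u c))
  hallCondition : HallCondition copy-adj copy-R
  hallCondition X X⊆copy-R = begin
    ∣ X ∣ᵇ                           ≤⟨ ∣∣ᵇ≤∣owners∣ᵇ*h m h X ⟩
    ∣ owners m h X ∣ᵇ * h              ≤⟨ expansion (owners m h X) owners⊆R ⟩
    ∣ neighbours adj (owners m h X) ∣ᵇ ≤⟨ ∣∣ᵇ-mono N[owners]⊆N ⟩
    ∣ neighbours copy-adj X ∣ᵇ       ∎
    where
    open ≤-Reasoning
    owners⊆R : owners m h X ⊆ᵇ R
    owners⊆R u Xu with c , Xuc ← anyFin-elim _ Xu =
      subst (λ z → R z ≡ true) (owner-combine u c) (X⊆copy-R (combine u c) Xuc)
    N[owners]⊆N : neighbours adj (owners m h X) ⊆ᵇ neighbours copy-adj X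
    N[owners]⊆N w w∈N with u , Xu , adjuw ← neighbours-elim w∈N with c , Xuc ← anyFin-elim _ Xu =
      neighbours-intro (combine u c) Xuc (subst (λ z → adj z w ≡ true) (sym (owner-combine u c)) adjuw)
  open Matching (hall y hallCondition)
  π : Fin m → Fin h → Fin b
  π u c = mate (combine u c)
  π-adjacent : ∀ u c → R u ≡ true → adj u (π u c) ≡ true
  π-adjacent u c Ru =
    subst (λ z → adj z (π u c) ≡ true) (owner-combine u c)
          (mate-adjacent (combine u c) (copy-R-combine u c Ru))
  π-injective : ∀ u v c d → R u ≡ true → R v ≡ true → π u c ≡ π v d → u ≡ v × c ≡ d
  π-injective u v c d Ru Rv πuc≡πvd =
    combine-injectiveˡ u c v d same-copy , combine-injectiveʳ u c v d same-copy
    where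
    same-copy : combine u c ≡ combine v d
    same-copy = mate-injective _ _ (copy-R-combine u c Ru) (copy-R-combine v d Rv) πuc≡πvd

-- The majority query scheme

count-tabulate : ∀ {A : Set} {n} (P : A → Bool) (f : Fin n → A) →
                 count (λ a → P a Bool.≟ true) (tabulate f) ≡ ∣ P ∘ f ∣ᵇ
count-tabulate {n = zero}  P f = refl
count-tabulate {n = suc n} P f with P (f zero)
... | true  = cong suc (count-tabulate P (f ∘ suc))
... | false = count-tabulate P (f ∘ suc)

∣tabulate∣ : ∀ {n} (p : Fin n → Bool) → ∣ tabulate p ∣ ≡ ∣ p ∣ᵇ
∣tabulate∣ = count-tabulate (λ b → b)

∣∣≡∣lookup∣ᵇ : ∀ {n} (V : Subset n) → ∣ V ∣ ≡ ∣ lookup V ∣ᵇ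
∣∣≡∣lookup∣ᵇ V = trans (cong ∣_∣ (sym (tabulate∘lookup V))) (∣tabulate∣ (lookup V))

lookup-∩ : ∀ {n} (V W : Subset n) x → lookup (V ∩ W) x ≡ lookup V x ∧ lookup W x
lookup-∩ V W x = lookup-zipWith _∧_ x V W

module _ {m s t : ℕ} (G : NAGraph m s t) where

  location : Fin m → Fin t → Fin (t * s)
  location u i = combine i (G u i)

  adjacent : Fin m → Fin (t * s) → Bool
  adjacent u w = G u (proj₁ (remQuot {t} s w)) ≡ᵇ proj₂ (remQuot {t} s w)

  adjacent-location : ∀ u i → adjacent u (location u i) ≡ true
  adjacent-location u i = subst (λ (j , v) → G u j ≡ᵇ v ≡ true) (sym (remQuot-combine i (G u i)))
                                (≡ᵇ-refl (G u i))

  adjacent⇒location : ∀ {u w} → adjacent u w ≡ true → location u (proj₁ (remQuot {t} s w)) ≡ w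
  adjacent⇒location {w = w} uw = trans (cong (combine (proj₁ (remQuot {t} s w))) (≡ᵇ⇒≡ uw))
                                        (combine-remQuot {t} s w)

  opaque
    unfolding _≡ᵇ_ neighbours

    lookup-Γ : ∀ R w → lookup (Γ G R) w ≡ neighbours adjacent (lookup R) w
    lookup-Γ R w = lookup∘tabulate _ w

    lookup-Γ₁ : ∀ u w → lookup (Γ₁ G u) w ≡ adjacent u w
    lookup-Γ₁ u w = lookup∘tabulate _ w

module MajorityMemory {m s t h} (G : NAGraph m s t) {S R : Fin m → Bool} (S⊆R : S ⊆ᵇ R)
                      (nbrs : PrivateNeighbours (adjacent G) R h) where

  open PrivateNeighbours nbrs

  marked : Fin (t * s) → Bool
  marked w = anyFin λ u → S u ∧ anyFin λ c → π u c ≡ᵇ w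

  memory : Memory s t
  memory i v = marked (combine i v)

  seen : Fin m → Fin t → Bool
  seen u i = memory i (G u i)

  ones≡∣seen∣ᵇ : ∀ u → ones G memory u ≡ ∣ seen u ∣ᵇ
  ones≡∣seen∣ᵇ u = count-tabulate (seen u) (λ i → i)

  marked-elim : ∀ {w} → marked w ≡ true → Σ[ v ∈ Fin m ] Σ[ d ∈ Fin h ] S v ≡ true × π v d ≡ w
  marked-elim e
    with v , Sv∧πv≡w ← anyFin-elim _ e
    with d , πvd≡w ← anyFin-elim _ (∧-conicalʳ (S v) _ Sv∧πv≡w)
    = v , d , ∧-conicalˡ (S v) _ Sv∧πv≡w , ≡ᵇ⇒≡ πvd≡w

  slot : Fin m → Fin h → Fin t
  slot u c = proj₁ (remQuot {t} s (π u c))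

  location-slot : ∀ {u} c → R u ≡ true → location G u (slot u c) ≡ π u c
  location-slot {u} c Ru = adjacent⇒location G (π-adjacent u c Ru)

  slot-injective : ∀ {u} → R u ≡ true → InjectiveOn (λ _ → true) (slot u)
  slot-injective {u} Ru c d _ _ slot≡ = proj₂ (π-injective u u c d Ru Ru (begin
    π u c                    ≡⟨ location-slot c Ru ⟨
    location G u (slot u c)  ≡⟨ cong (location G u) slot≡ ⟩
    location G u (slot u d)  ≡⟨ location-slot d Ru ⟩
    π u d                    ∎))
    where open ≡-Reasoning

  h≤ones : ∀ {u} → S u ≡ true → h ≤ ones G memory u
  h≤ones {u} Su = begin
    h                            ≡⟨ ∣true∣ᵇ≡n h ⟨
    ∣ (λ (_ : Fin h) → true) ∣ᵇ  ≤⟨ ∣∣ᵇ-injection _ _ (slot u) slot-marked (slot-injective Ru) ⟩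
    ∣ seen u ∣ᵇ                  ≡⟨ ones≡∣seen∣ᵇ u ⟨
    ones G memory u              ∎
    where
    open ≤-Reasoning
    Ru = S⊆R u Su
    slot-marked : ∀ c → true ≡ true → marked (location G u (slot u c)) ≡ true
    slot-marked c _ rewrite location-slot c Ru =
      anyFin-intro _ u (∧-intro Su (anyFin-intro _ c (≡ᵇ-refl (π u c))))

  ones+h≤t : ∀ {u} → S u ≡ false → R u ≡ true → ones G memory u + h ≤ t
  ones+h≤t {u} Su Ru = begin
    ones G memory u + h                             ≡⟨ cong₂ _+_ (ones≡∣seen∣ᵇ u) (sym (∣true∣ᵇ≡n h)) ⟩
    ∣ seen u ∣ᵇ + ∣ (λ (_ : Fin h) → true) ∣ᵇ       ≤⟨ +-monoʳ-≤ ∣ seen u ∣ᵇ h≤unseen ⟩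
    ∣ seen u ∣ᵇ + ∣ not ∘ seen u ∣ᵇ                 ≡⟨ ∣∣ᵇ+∣not∣ᵇ≡n (seen u) ⟩
    t                                               ∎
    where
    open ≤-Reasoning
    slot-unmarked : ∀ c → true ≡ true → not (marked (location G u (slot u c))) ≡ true
    slot-unmarked c _ rewrite location-slot c Ru with marked (π u c) in mark
    ... | false = refl
    ... | true with v , d , Sv , πvd≡πuc ← marked-elim mark
                with refl ← proj₁ (π-injective v u d c (S⊆R v Sv) Ru πvd≡πuc)
                = ⊥-elim (true≢false Sv Su)
    h≤unseen : ∣ (λ (_ : Fin h) → true) ∣ᵇ ≤ ∣ not ∘ seen u ∣ᵇ
    h≤unseen = ∣∣ᵇ-injection _ (not ∘ seen u) (slot u) slot-unmarked (slot-injective Ru)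

  ones≤∣Γ₁∩Γ∣ : ∀ {S′ : Subset m} u → S ⊆ᵇ lookup S′ → ones G memory u ≤ ∣ Γ₁ G u ∩ Γ G S′ ∣
  ones≤∣Γ₁∩Γ∣ {S′} u S⊆S′ = begin
    ones G memory u                ≡⟨ ones≡∣seen∣ᵇ u ⟩
    ∣ seen u ∣ᵇ                    ≤⟨ ∣∣ᵇ-injection _ _ (location G u) marked⇒common location-injective ⟩
    ∣ lookup (Γ₁ G u ∩ Γ G S′) ∣ᵇ  ≡⟨ ∣∣≡∣lookup∣ᵇ (Γ₁ G u ∩ Γ G S′) ⟨
    ∣ Γ₁ G u ∩ Γ G S′ ∣            ∎
    where
    open ≤-Reasoning
    location-injective : InjectiveOn (seen u) (location G u)
    location-injective i j _ _ = combine-injectiveˡ i (G u i) j (G u j)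
    marked⇒common : ∀ i → marked (location G u i) ≡ true →
                    lookup (Γ₁ G u ∩ Γ G S′) (location G u i) ≡ true
    marked⇒common i mark with v , d , Sv , πvd≡w ← marked-elim mark =
      trans (lookup-∩ (Γ₁ G u) (Γ G S′) w)
            (trans (cong₂ _∧_ (lookup-Γ₁ G u w) (lookup-Γ G S′ w))
                   (∧-intro (adjacent-location G u i) (neighbours-intro v (S⊆S′ v Sv) adjvw)))
      where
      w = location G u i
      adjvw : adjacent G v w ≡ true
      adjvw = subst (λ z → adjacent G v z ≡ true) πvd≡w (π-adjacent v d (S⊆R v Sv))

odd⇒suc≡2* : ∀ t → ¬ (2 ∣ t) → Σ[ h ∈ ℕ ] suc t ≡ 2 * h
odd⇒suc≡2* zero          ¬2∣t = contradiction (2 ∣0) ¬2∣t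
odd⇒suc≡2* (suc zero)    _    = 1 , refl
odd⇒suc≡2* (suc (suc t)) ¬2∣t with h , 1+t≡2h ← odd⇒suc≡2* t (¬2∣t ∘ ∣m∣n⇒∣m+n ∣-refl) =
  suc h , trans (cong (2 +_) 1+t≡2h) (sym (*-suc 2 h))

majority-excluded : ∀ o {h t} → o + h ≤ t → suc t ≡ 2 * h → ¬ (suc t ≤ 2 * o)
majority-excluded o {h} {t} o+h≤t 1+t≡2h 1+t≤2o = <-irrefl refl (begin-strict
  t        <⟨ n<1+n t ⟩
  suc t    ≡⟨ 1+t≡2h ⟩
  2 * h    ≡⟨ cong (h +_) (+-identityʳ h) ⟩
  h + h    ≤⟨ +-monoˡ-≤ h h≤o ⟩
  o + h    ≤⟨ o+h≤t ⟩
  t        ∎)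
  where
  open ≤-Reasoning
  h≤o : h ≤ o
  h≤o = *-cancelˡ-≤ 2 (subst (_≤ 2 * o) 1+t≡2h 1+t≤2o)

∉T⇒few-common : ∀ {m s t} (G : NAGraph m s t) (S′ : Subset m) {u} →
                lookup S′ u ≡ false → lookup (T G S′) u ≡ false →
                ¬ (suc t ≤ 2 * ∣ Γ₁ G u ∩ Γ G S′ ∣)
∉T⇒few-common {t = t} G S′ {u} S′u Tu 1+t≤ = subst Bool.T few (≤⇒≤ᵇ 1+t≤)
  where
  common = suc t ≤ᵇ 2 * ∣ Γ₁ G u ∩ Γ G S′ ∣
  few : common ≡ false
  few = trans (cong (λ b → not b ∧ common) (sym S′u))
              (trans (sym (lookup∘tabulate _ u)) Tu)

satisfiable : ∀ {m s t h} (G : NAGraph m s t) (S S′ : Subset m) → suc t ≡ 2 * h →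
              lookup S ⊆ᵇ lookup S′ →
              PrivateNeighbours (adjacent G) (λ u → lookup S′ u ∨ lookup (T G S′) u) h →
              Satisfiable G S
satisfiable {m} G S S′ 1+t≡2h S⊆S′ nbrs = memory , decide
  where
  R : Fin m → Bool
  R u = lookup S′ u ∨ lookup (T G S′) u
  open MajorityMemory G {lookup S} {R} (λ u Su → ∨-introˡ _ (S⊆S′ u Su)) nbrs
  rejected : ∀ {u} → lookup S u ≡ false → ¬ answersYes G memory u
  rejected {u} Su with R u in Ru
  ... | true  = majority-excluded (ones G memory u) (ones+h≤t Su Ru) 1+t≡2h
  ... | false = λ yes →
    ∉T⇒few-common G S′ (∨-conicalˡ (lookup S′ u) _ Ru) (∨-conicalʳ (lookup S′ u) _ Ru)
                  (≤-trans yes (*-monoʳ-≤ 2 (ones≤∣Γ₁∩Γ∣ {S′} u S⊆S′)))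
  decide : ∀ u → answersYes G memory u ⇔ u ∈ S
  decide u with lookup S u in Su
  ... | true  = mk⇔ (λ _ → lookup⇒[]= u S Su)
                    (λ _ → subst (_≤ 2 * ones G memory u) (sym 1+t≡2h) (*-monoʳ-≤ 2 (h≤ones Su)))
  ... | false = mk⇔ (λ yes → ⊥-elim (rejected Su yes))
                    (λ u∈S → ⊥-elim (true≢false ([]=⇒lookup u∈S) Su))

expansion : ∀ {m s t h K} (G : NAGraph m s t) {R : Fin m → Bool} → suc t ≡ 2 * h →
            ((R′ : Subset m) → ∣ R′ ∣ ≤ K → suc t * ∣ R′ ∣ ≤ 2 * ∣ Γ G R′ ∣) → ∣ R ∣ᵇ ≤ K →
            ∀ P → P ⊆ᵇ R → ∣ P ∣ᵇ * h ≤ ∣ neighbours (adjacent G) P ∣ᵇ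
expansion {t = t} {h} G 1+t≡2h P1 |R|≤K P P⊆R = *-cancelˡ-≤ 2 (begin
  2 * (∣ P ∣ᵇ * h)                     ≡⟨ cong (2 *_) (*-comm ∣ P ∣ᵇ h) ⟩
  2 * (h * ∣ P ∣ᵇ)                     ≡⟨ *-assoc 2 h ∣ P ∣ᵇ ⟨
  2 * h * ∣ P ∣ᵇ                       ≡⟨ cong (_* ∣ P ∣ᵇ) 1+t≡2h ⟨
  suc t * ∣ P ∣ᵇ                       ≡⟨ cong (suc t *_) (∣tabulate∣ P) ⟨
  suc t * ∣ tabulate P ∣               ≤⟨ P1 (tabulate P) |P|≤K ⟩
  2 * ∣ Γ G (tabulate P) ∣             ≡⟨ cong (2 *_) (∣∣≡∣lookup∣ᵇ (Γ G (tabulate P))) ⟩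
  2 * ∣ lookup (Γ G (tabulate P)) ∣ᵇ   ≤⟨ *-monoʳ-≤ 2 (∣∣ᵇ-mono ΓP⊆NP) ⟩
  2 * ∣ neighbours (adjacent G) P ∣ᵇ   ∎)
  where
  open ≤-Reasoning
  |P|≤K : ∣ tabulate P ∣ ≤ _
  |P|≤K = ≤-trans (≤-reflexive (∣tabulate∣ P)) (≤-trans (∣∣ᵇ-mono P⊆R) |R|≤K)
  ΓP⊆NP : lookup (Γ G (tabulate P)) ⊆ᵇ neighbours (adjacent G) P
  ΓP⊆NP w w∈Γ = neighbours-mono {adj = adjacent G} (λ _ _ _ a → a)
                                (λ x → trans (sym (lookup∘tabulate P x)))
                                w (trans (sym (lookup-Γ G (tabulate P) w)) w∈Γ)

lemma7 : (m s t n k : ℕ) → 5 ≤ t → ¬ (2 ∣ t) → 1 ≤ n → n ≤ m →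
         IsCeilBound n m k →
         (G : NAGraph m s t) → Admissible G n k →
         (S : Subset m) → ∣ S ∣ ≤ n → Satisfiable G S
-- k enters only through (P1) and (P2).
lemma7 m s t n k 5≤t t-odd 1≤n n≤m _ G (P1 , P2) S |S|≤n
  with h , 1+t≡2h ← odd⇒suc≡2* t t-odd
  with S′ , S⊆S′ , |S′|≡n ← superset-of-size (lookup S) n (subst (_≤ n) (∣∣≡∣lookup∣ᵇ S) |S|≤n) n≤m =
  satisfiable G S V 1+t≡2h S⊆V (privateNeighbours h vertex (expansion G 1+t≡2h P1 |R|≤n+k))
  where
  V : Subset m
  V = tabulate S′
  S⊆V : lookup S ⊆ᵇ lookup V
  S⊆V u Su = trans (lookup∘tabulate S′ u) (S⊆S′ u Su)
  |V|≡n : ∣ V ∣ ≡ n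
  |V|≡n = trans (∣tabulate∣ S′) |S′|≡n
  |R|≤n+k : ∣ (λ u → lookup V u ∨ lookup (T G V) u) ∣ᵇ ≤ n + k
  |R|≤n+k = ≤-trans (∣∪∣ᵇ≤ (lookup V) (lookup (T G V)))
                    (+-mono-≤ (≤-reflexive (trans (sym (∣∣≡∣lookup∣ᵇ V)) |V|≡n))
                              (≤-trans (≤-reflexive (sym (∣∣≡∣lookup∣ᵇ (T G V)))) (P2 V |V|≡n)))
  -- The values of the matching outside R are irrelevant; 5 ≤ t is needed only here.
  vertex : Fin (t * s)
  vertex = location G (fromℕ< (≤-trans 1≤n n≤m)) (fromℕ< (≤-trans (s≤s z≤n) 5≤t))
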